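{- Let $s>0$ be an integer, $n\ge 3$, and $1\le i<j\le n$. Let $H$ be the graph with signature $\{s,2s,\dots,ns\}\setminus\{is,js\}$. Then for every $p\in\{1,\dots,n\}\setminus\{i,j\}$, the degree of the vertex labeled $ps$ in $H$ is $$\deg(ps)=\epsilon_i+\epsilon_j+\gamma_{ij}+\beta_{ij}+\begin{cases} n-7 & \text{if } j<p\le n-j,\\ n-6 & \text{if } \max(j,n-j)<p\le n-i \text{ or } i<p\le\min(n-j,j),\\ n-4 & \text{if } \max(i,n-i)<p<j \text{ or } n-j<p\le\min(n-i,i),\\ n-3 & \text{if } n-i<p<i,\\ n-5 & \text{otherwise},\end{cases}$$ where $\epsilon_i=1$ if $p=2i$ and $i\le\lfloor n/2\rfloor$ and $\epsilon_i=0$ otherwise; $\epsilon_j=1$ if $p=2j$ and $j\le\lfloor n/2\rfloor$ and $\epsilon_j=0$ otherwise; $\gamma_{ij}=2$ if $p=i+j$ and $0$ otherwise; $\beta_{ij}=1$ if $p=j-i$ and $0$ otherwise.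
   Context: For a finite set $S$ of integers, the graph with signature $S$ has vertex set $S$, and distinct $a,b\in S$ are adjacent iff $|a-b|\in S$. -}

module Defs where

open import Data.Bool using (Bool; true; false; if_then_else_; _∧_; _∨_; not)
open import Data.Nat as ℕ using (ℕ; suc; _∸_; _/_)
open import Data.Integer as ℤ using (ℤ; +_; ∣_∣)
open import Data.List using (List; []; _∷_; filterᵇ; map; length; upTo)
open import Relation.Nullary using (does)

memᵇ : ℤ → List ℤ → Bool
memᵇ x []       = false
memᵇ x (y ∷ ys) = does (x ℤ.≟ y) ∨ memᵇ x ys

-- The graph with signature S (a finite set of integers, given as a list):
-- vertex set S, distinct a b ∈ S adjacent iff |a - b| ∈ S.
adjᵇ : List ℤ → ℤ → ℤ → Bool
adjᵇ S a b = not (does (a ℤ.≟ b)) ∧ memᵇ a S ∧ memᵇ b S ∧ memᵇ (+ ∣ a ℤ.- b ∣) S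

degree : List ℤ → ℤ → ℕ
degree S a = length (filterᵇ (adjᵇ S a) S)

oneTo : ℕ → List ℕ
oneTo n = map suc (upTo n)

sigH : ℕ → ℕ → ℕ → ℕ → List ℤ
sigH s n i j =
  map (λ k → + (k ℕ.* s))
      (filterᵇ (λ k → not (does (k ℕ.≟ i)) ∧ not (does (k ℕ.≟ j))) (oneTo n))

_≤ᵇ_ : ℕ → ℕ → Bool
m ≤ᵇ n = does (m ℕ.≤? n)

_<ᵇ_ : ℕ → ℕ → Bool
m <ᵇ n = does (m ℕ.<? n)

_==_ : ℕ → ℕ → Bool
m == n = does (m ℕ.≟ n)

ind : Bool → ℕ → ℕ
ind b k = if b then k else 0

extras : ℕ → ℕ → ℕ → ℕ → ℕ
extras n i j p =
    ind ((p == (2 ℕ.* i)) ∧ (i ≤ᵇ (n / 2))) 1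
  ℕ.+ ind ((p == (2 ℕ.* j)) ∧ (j ≤ᵇ (n / 2))) 1
  ℕ.+ ind (p == (i ℕ.+ j)) 2
  ℕ.+ ind (p == (j ∸ i)) 1

-- The case-defined term (cases checked in the order listed in the paper;
-- they are pairwise disjoint, so the order is immaterial).
caseTerm : ℕ → ℕ → ℕ → ℕ → ℤ
caseTerm n i j p =
  if (j <ᵇ p) ∧ (p ≤ᵇ (n ∸ j)) then + n ℤ.- + 7
  else if ((ℕ._⊔_ j (n ∸ j) <ᵇ p) ∧ (p ≤ᵇ (n ∸ i)))
          ∨ ((i <ᵇ p) ∧ (p ≤ᵇ ℕ._⊓_ (n ∸ j) j)) then + n ℤ.- + 6
  else if ((ℕ._⊔_ i (n ∸ i) <ᵇ p) ∧ (p <ᵇ j))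
          ∨ (((n ∸ j) <ᵇ p) ∧ (p ≤ᵇ ℕ._⊓_ (n ∸ i) i)) then + n ℤ.- + 4
  else if ((n ∸ i) <ᵇ p) ∧ (p <ᵇ i) then + n ℤ.- + 3
  else + n ℤ.- + 5

module Submission where

-- Write the vertices of H as ks (k ∈ [1, n], k ∉ {i, j}) and fix the vertex ps.
-- A label q gives a neighbour qs exactly when q ∈ [1, n] avoids the seven
-- forbidden values i, j, p, p + i, p ∸ i, p + j, p ∸ j: membership in H excludes
-- i and j, adjacency needs q ≠ p and |p - q| ∉ {i, j}, and |p - q| ∈ [1, n]
-- holds automatically.  So deg(ps) = n − #(distinct forbidden values in [1, n])
-- (general complement counting for an arbitrary list of excluded values).
-- Among the forbidden values, i, j, p are always distinct labels; p + i is a new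
-- label iff p + i ≤ n and p ≠ j − i; p ∸ i iff i < p, p ≠ 2i, p ≠ i + j;
-- p + j iff p + j ≤ n; p ∸ j iff j < p, p ≠ 2j, p ≠ i + j.  Hence their number
-- is 3 + [i<p] + [j<p] + [p≤n−i] + [p≤n−j] − (ε_i + ε_j + 2γ + β), while the
-- paper's five-way case term equals n − 3 − ([i<p] + [j<p] + [p≤n−i] + [p≤n−j]).

open import Defs
import Algebra.Solver.IdempotentCommutativeMonoid as ICM-Solver
open import Data.Bool using (Bool; true; false; if_then_else_; _∧_; _∨_; not; T)
open import Data.Bool.Properties
  using (∧-zeroʳ; ∧-identityʳ; ∨-identityʳ; ∨-assoc; ∧-idempotentCommutativeMonoid)
open import Data.Empty using (⊥-elim)
open import Data.Fin using (#_)
open import Data.Integer as ℤ using (ℤ; +_; ∣_∣)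
import Data.Integer.Properties as ℤP
open import Data.Integer.Tactic.RingSolver renaming (solve-∀ to ℤ-solve-∀)
open import Data.List using (List; []; _∷_; filterᵇ; map; length; upTo; _++_; [_])
open import Data.List.Properties using (upTo-∷ʳ; map-++; filter-++; length-++)
open import Data.Nat as ℕ using (ℕ; zero; suc; _∸_; _/_; _≤_; _<_; _*_; _+_; z≤n; s≤s)
open import Data.Nat.DivMod using (/-monoˡ-≤; m*n/n≡m)
import Data.Nat.Properties as ℕP
open import Data.Nat.Tactic.RingSolver using (solve-∀)
open import Data.Product using (_×_; _,_)
open import Data.Sum using (inj₁; inj₂)
open import Data.Vec using ([]; _∷_)
open import Function using (_∘_)
open import Function.Bundles using (mk⇔)
open import Relation.Binary.PropositionalEquality
  using (_≡_; _≢_; refl; sym; trans; subst; cong; cong₂; module ≡-Reasoning)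
open import Relation.Nullary using (does; Dec; yes; no; ¬_)
open import Relation.Nullary.Decidable using (dec-true; dec-false; does-⇔)
open import Relation.Nullary.Decidable.Core using (T?; _×-dec_; ¬?)

inRange : ℕ → ℕ → Bool
inRange n q = (1 ≤ᵇ q) ∧ (q ≤ᵇ n)

inRange-zero : ∀ q → inRange 0 q ≡ false
inRange-zero zero    = refl
inRange-zero (suc q) = refl

inRange-top : ∀ n → inRange (suc n) (suc n) ≡ true
inRange-top n = cong (true ∧_) (dec-true (suc n ℕ.≤? suc n) ℕP.≤-refl)

inRange-beyond : ∀ n → inRange n (suc n) ≡ false
inRange-beyond n = cong (true ∧_) (dec-false (suc n ℕ.≤? n) (ℕP.n≮n n))

inRange-other : ∀ n q → q ≢ suc n → inRange (suc n) q ≡ inRange n q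
inRange-other n q q≢ = cong ((1 ≤ᵇ q) ∧_) (does-⇔ (mk⇔ shrink ℕP.m≤n⇒m≤1+n) (q ℕ.≤? suc n) (q ℕ.≤? n))
  where
  shrink : q ≤ suc n → q ≤ n
  shrink q≤ = ℕP.≤-pred (ℕP.≤∧≢⇒< q≤ q≢)

count : ℕ → (ℕ → Bool) → ℕ
count n P = length (filterᵇ P (oneTo n))

oneTo-suc : ∀ n → oneTo (suc n) ≡ oneTo n ++ [ suc n ]
oneTo-suc n = begin
  map suc (upTo (suc n))   ≡⟨ cong (map suc) (upTo-∷ʳ n) ⟨
  map suc (upTo n ++ [ n ]) ≡⟨ map-++ suc (upTo n) [ n ] ⟩
  oneTo n ++ [ suc n ]     ∎
  where open ≡-Reasoning

count-suc : ∀ n P → count (suc n) P ≡ count n P + ind (P (suc n)) 1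
count-suc n P = begin
  length (filterᵇ P (oneTo (suc n)))
    ≡⟨ cong (length ∘ filterᵇ P) (oneTo-suc n) ⟩
  length (filterᵇ P (oneTo n ++ [ suc n ]))
    ≡⟨ cong length (filter-++ (T? ∘ P) (oneTo n) [ suc n ]) ⟩
  length (filterᵇ P (oneTo n) ++ filterᵇ P [ suc n ])
    ≡⟨ length-++ (filterᵇ P (oneTo n)) ⟩
  count n P + length (filterᵇ P [ suc n ])
    ≡⟨ cong (λ k → count n P + k) (singleton (P (suc n)) refl) ⟩
  count n P + ind (P (suc n)) 1 ∎
  where
  open ≡-Reasoning
  singleton : ∀ b → P (suc n) ≡ b → length (filterᵇ P [ suc n ]) ≡ ind b 1
  singleton true  eq rewrite eq = refl
  singleton false eq rewrite eq = refl

count-cong : ∀ n P Q → (∀ q → 1 ≤ q → q ≤ n → P q ≡ Q q) → count n P ≡ count n Q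
count-cong zero    P Q P≗Q = refl
count-cong (suc n) P Q P≗Q = begin
  count (suc n) P                ≡⟨ count-suc n P ⟩
  count n P + ind (P (suc n)) 1
    ≡⟨ cong₂ (λ x b → x + ind b 1)
         (count-cong n P Q (λ q 1≤q q≤n → P≗Q q 1≤q (ℕP.m≤n⇒m≤1+n q≤n)))
         (P≗Q (suc n) (s≤s z≤n) ℕP.≤-refl) ⟩
  count n Q + ind (Q (suc n)) 1  ≡⟨ count-suc n Q ⟨
  count (suc n) Q                ∎
  where open ≡-Reasoning

count-all : ∀ n → count n (λ _ → true) ≡ n
count-all zero    = refl
count-all (suc n) = trans (count-suc n _) (trans (cong (_+ 1) (count-all n)) (ℕP.+-comm n 1))

length-filter-split : ∀ (b P : ℕ → Bool) xs →
  length (filterᵇ P xs) ≡ length (filterᵇ (λ q → b q ∧ P q) xs) + length (filterᵇ (λ q → not (b q) ∧ P q) xs)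
length-filter-split b P [] = refl
length-filter-split b P (x ∷ xs) with b x | P x
... | true  | true  = cong suc (length-filter-split b P xs)
... | false | true  = trans (cong suc (length-filter-split b P xs)) (sym (ℕP.+-suc _ _))
... | true  | false = length-filter-split b P xs
... | false | false = length-filter-split b P xs

count-single : ∀ n (P : ℕ → Bool) a → count n (λ q → (q == a) ∧ P q) ≡ ind (inRange n a ∧ P a) 1
count-single zero    P a rewrite inRange-zero a = refl
count-single (suc n) P a = begin
  count (suc n) at-a                                    ≡⟨ count-suc n at-a ⟩
  count n at-a + ind (at-a (suc n)) 1                   ≡⟨ cong (λ k → k + ind (at-a (suc n)) 1) (count-single n P a) ⟩
  ind (inRange n a ∧ P a) 1 + ind (at-a (suc n)) 1      ≡⟨ new-top (suc n ℕ.≟ a) ⟩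
  ind (inRange (suc n) a ∧ P a) 1                       ∎
  where
  open ≡-Reasoning
  at-a : ℕ → Bool
  at-a q = (q == a) ∧ P q
  new-top : Dec (suc n ≡ a) →
    ind (inRange n a ∧ P a) 1 + ind (at-a (suc n)) 1 ≡ ind (inRange (suc n) a ∧ P a) 1
  new-top (yes refl) rewrite inRange-beyond n | inRange-top n
                           | dec-true (suc n ℕ.≟ suc n) refl = refl
  new-top (no n+1≢a) rewrite dec-false (suc n ℕ.≟ a) n+1≢a
                           | inRange-other n a (n+1≢a ∘ sym) = ℕP.+-identityʳ _

notIn : List ℕ → ℕ → Bool
notIn []       q = true
notIn (a ∷ as) q = not (q == a) ∧ notIn as q

-- Number of distinct elements of the list lying in [1, n]
-- (a repeated value is counted at its last occurrence).
distinctIn : ℕ → List ℕ → ℕ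
distinctIn n []       = 0
distinctIn n (a ∷ as) = ind (inRange n a ∧ notIn as a) 1 + distinctIn n as

count-avoiding : ∀ n L → count n (notIn L) + distinctIn n L ≡ n
count-avoiding n [] = trans (ℕP.+-identityʳ _) (count-all n)
count-avoiding n (a ∷ as) = begin
  count n (notIn (a ∷ as)) + (new + distinctIn n as)  ≡⟨ ℕP.+-assoc (count n (notIn (a ∷ as))) new (distinctIn n as) ⟨
  count n (notIn (a ∷ as)) + new + distinctIn n as    ≡⟨ cong (_+ distinctIn n as) (ℕP.+-comm _ new) ⟩
  new + count n (notIn (a ∷ as)) + distinctIn n as
    ≡⟨ cong₂ (λ x y → x + y + distinctIn n as) (count-single n (notIn as) a) refl ⟨
  count n (λ q → (q == a) ∧ notIn as q) + count n (notIn (a ∷ as)) + distinctIn n as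
    ≡⟨ cong (_+ distinctIn n as) (length-filter-split (_== a) (notIn as) (oneTo n)) ⟨
  count n (notIn as) + distinctIn n as                ≡⟨ count-avoiding n as ⟩
  n                                                   ∎
  where
  open ≡-Reasoning
  new = ind (inRange n a ∧ notIn as a) 1

elemᵇ : ℕ → List ℕ → Bool
elemᵇ k []       = false
elemᵇ k (x ∷ xs) = (k == x) ∨ elemᵇ k xs

elemᵇ-++ : ∀ k xs ys → elemᵇ k (xs ++ ys) ≡ elemᵇ k xs ∨ elemᵇ k ys
elemᵇ-++ k []       ys = refl
elemᵇ-++ k (x ∷ xs) ys = trans (cong ((k == x) ∨_) (elemᵇ-++ k xs ys)) (sym (∨-assoc (k == x) _ _))

elemᵇ-filter : ∀ (F : ℕ → Bool) k xs → elemᵇ k (filterᵇ F xs) ≡ F k ∧ elemᵇ k xs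
elemᵇ-filter F k []       = sym (∧-zeroʳ (F k))
elemᵇ-filter F k (x ∷ xs) = step (k ℕ.≟ x) (F x) refl
  where
  step : Dec (k ≡ x) → ∀ b → F x ≡ b → elemᵇ k (filterᵇ F (x ∷ xs)) ≡ F k ∧ elemᵇ k (x ∷ xs)
  step (yes refl) true  Fk rewrite Fk | dec-true (k ℕ.≟ k) refl = refl
  step (yes refl) false Fk rewrite Fk = trans (elemᵇ-filter F k xs) (cong (_∧ _) Fk)
  step (no k≢x)   true  Fx rewrite Fx | dec-false (k ℕ.≟ x) k≢x = elemᵇ-filter F k xs
  step (no k≢x)   false Fx rewrite Fx | dec-false (k ℕ.≟ x) k≢x = elemᵇ-filter F k xs

elemᵇ-oneTo : ∀ k n → elemᵇ k (oneTo n) ≡ inRange n k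
elemᵇ-oneTo k zero    = sym (inRange-zero k)
elemᵇ-oneTo k (suc n) = begin
  elemᵇ k (oneTo (suc n))                    ≡⟨ cong (elemᵇ k) (oneTo-suc n) ⟩
  elemᵇ k (oneTo n ++ [ suc n ])              ≡⟨ elemᵇ-++ k (oneTo n) [ suc n ] ⟩
  elemᵇ k (oneTo n) ∨ ((k == suc n) ∨ false)  ≡⟨ cong (_∨ ((k == suc n) ∨ false)) (elemᵇ-oneTo k n) ⟩
  inRange n k ∨ ((k == suc n) ∨ false)        ≡⟨ top (k ℕ.≟ suc n) ⟩
  inRange (suc n) k                           ∎
  where
  open ≡-Reasoning
  top : Dec (k ≡ suc n) → inRange n k ∨ ((k == suc n) ∨ false) ≡ inRange (suc n) k
  top (yes refl) rewrite dec-true (k ℕ.≟ k) refl | inRange-beyond n = sym (inRange-top n)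
  top (no k≢)    rewrite dec-false (k ℕ.≟ suc n) k≢ = trans (∨-identityʳ _) (sym (inRange-other n k k≢))

kept : ℕ → ℕ → ℕ → Bool
kept i j k = not (k == i) ∧ not (k == j)

scaled-== : ∀ s k m → 0 < s → does (+ (k * s) ℤ.≟ + (m * s)) ≡ (k == m)
scaled-== s k m s>0 = does-⇔ (mk⇔ cancel (cong (λ x → + (x * s)))) (+ (k * s) ℤ.≟ + (m * s)) (k ℕ.≟ m)
  where
  cancel : + (k * s) ≡ + (m * s) → k ≡ m
  cancel eq = ℕP.*-cancelʳ-≡ k m s {{ℕ.>-nonZero s>0}} (ℤP.+-injective eq)

memᵇ-scaled : ∀ s k xs → 0 < s → memᵇ (+ (k * s)) (map (λ m → + (m * s)) xs) ≡ elemᵇ k xs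
memᵇ-scaled s k []       s>0 = refl
memᵇ-scaled s k (x ∷ xs) s>0 = cong₂ _∨_ (scaled-== s k x s>0) (memᵇ-scaled s k xs s>0)

memᵇ-sigH : ∀ s n i j k → 0 < s → memᵇ (+ (k * s)) (sigH s n i j) ≡ kept i j k ∧ inRange n k
memᵇ-sigH s n i j k s>0 = begin
  memᵇ (+ (k * s)) (sigH s n i j)                ≡⟨ memᵇ-scaled s k (filterᵇ (kept i j) (oneTo n)) s>0 ⟩
  elemᵇ k (filterᵇ (kept i j) (oneTo n))         ≡⟨ elemᵇ-filter (kept i j) k (oneTo n) ⟩
  kept i j k ∧ elemᵇ k (oneTo n)                 ≡⟨ cong (kept i j k ∧_) (elemᵇ-oneTo k n) ⟩
  kept i j k ∧ inRange n k                       ∎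
  where open ≡-Reasoning

length-filter-map : ∀ {A : Set} (P : A → Bool) (φ : ℕ → A) xs →
  length (filterᵇ P (map φ xs)) ≡ length (filterᵇ (P ∘ φ) xs)
length-filter-map P φ []       = refl
length-filter-map P φ (x ∷ xs) with P (φ x)
... | true  = cong suc (length-filter-map P φ xs)
... | false = length-filter-map P φ xs

length-filter-filter : ∀ (Q F : ℕ → Bool) xs →
  length (filterᵇ Q (filterᵇ F xs)) ≡ length (filterᵇ (λ k → F k ∧ Q k) xs)
length-filter-filter Q F []       = refl
length-filter-filter Q F (x ∷ xs) with F x
... | false = length-filter-filter Q F xs
... | true with Q x
...   | true  = cong suc (length-filter-filter Q F xs)
...   | false = length-filter-filter Q F xs

degree-as-count : ∀ s n i j p → degree (sigH s n i j) (+ (p * s)) ≡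
  count n (λ q → kept i j q ∧ adjᵇ (sigH s n i j) (+ (p * s)) (+ (q * s)))
degree-as-count s n i j p =
  trans (length-filter-map (adjᵇ (sigH s n i j) (+ (p * s))) (λ k → + (k * s)) (filterᵇ (kept i j) (oneTo n)))
        (length-filter-filter _ (kept i j) (oneTo n))

positive-∸ : ∀ {p d} → 1 ≤ p ∸ d → d < p
positive-∸ 1≤p∸d = ℕP.m∸n≢0⇒n<m (λ p∸d≡0 → ℕP.n≮0 (subst (1 ≤_) p∸d≡0 1≤p∸d))

distance-scaled : ∀ p q s → ∣ + (p * s) ℤ.- + (q * s) ∣ ≡ ℕ.∣ p - q ∣ * s
distance-scaled p q s = begin
  ∣ + (p * s) ℤ.- + (q * s) ∣  ≡⟨ cong ∣_∣ (ℤP.[+m]-[+n]≡m⊖n (p * s) (q * s)) ⟩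
  ∣ p * s ℤ.⊖ q * s ∣          ≡⟨ ∣⊖∣≡∣-∣ (p * s) (q * s) ⟩
  ℕ.∣ p * s - q * s ∣          ≡⟨ ℕP.*-distribʳ-∣-∣ s p q ⟨
  ℕ.∣ p - q ∣ * s              ∎
  where
  open ≡-Reasoning
  ∣⊖∣≡∣-∣ : ∀ m n → ∣ m ℤ.⊖ n ∣ ≡ ℕ.∣ m - n ∣
  ∣⊖∣≡∣-∣ m n with ℕP.≤-total m n
  ... | inj₁ m≤n = trans (ℤP.∣⊖∣-≤ m≤n) (sym (ℕP.m≤n⇒∣m-n∣≡n∸m m≤n))
  ... | inj₂ n≤m = trans (ℤP.∣m⊖n∣≡∣n⊖m∣ m n) (trans (ℤP.∣⊖∣-≤ n≤m) (sym (ℕP.m≤n⇒∣n-m∣≡n∸m n≤m)))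

distance-== : ∀ p q d → 1 ≤ q → 1 ≤ d → (ℕ.∣ p - q ∣ == d) ≡ (q == (p + d)) ∨ (q == (p ∸ d))
distance-== p q d 1≤q 1≤d with ℕP.≤-total q p
... | inj₁ q≤p = begin
  (ℕ.∣ p - q ∣ == d)               ≡⟨ cong (_== d) (ℕP.m≤n⇒∣n-m∣≡n∸m q≤p) ⟩
  ((p ∸ q) == d)                   ≡⟨ does-⇔ (mk⇔ down up) (p ∸ q ℕ.≟ d) (q ℕ.≟ p ∸ d) ⟩
  (q == (p ∸ d))                   ≡⟨ cong (_∨ (q == (p ∸ d))) (dec-false (q ℕ.≟ p + d) not-above) ⟨
  (q == (p + d)) ∨ (q == (p ∸ d))  ∎
  where
  open ≡-Reasoning
  down : p ∸ q ≡ d → q ≡ p ∸ d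
  down refl = sym (ℕP.m∸[m∸n]≡n q≤p)
  up : q ≡ p ∸ d → p ∸ q ≡ d
  up refl = ℕP.m∸[m∸n]≡n (ℕP.<⇒≤ (positive-∸ 1≤q))
  not-above : q ≢ p + d
  not-above q≡p+d = ℕP.<⇒≢ (ℕP.≤-<-trans q≤p (ℕP.m<m+n p 1≤d)) q≡p+d
... | inj₂ p≤q = begin
  (ℕ.∣ p - q ∣ == d)               ≡⟨ cong (_== d) (ℕP.m≤n⇒∣m-n∣≡n∸m p≤q) ⟩
  ((q ∸ p) == d)                   ≡⟨ does-⇔ (mk⇔ up down) (q ∸ p ℕ.≟ d) (q ℕ.≟ p + d) ⟩
  (q == (p + d))                   ≡⟨ ∨-identityʳ (q == (p + d)) ⟨
  (q == (p + d)) ∨ false           ≡⟨ cong ((q == (p + d)) ∨_) (dec-false (q ℕ.≟ p ∸ d) not-below) ⟨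
  (q == (p + d)) ∨ (q == (p ∸ d))  ∎
  where
  open ≡-Reasoning
  up : q ∸ p ≡ d → q ≡ p + d
  up refl = sym (ℕP.m+[n∸m]≡n p≤q)
  down : q ≡ p + d → q ∸ p ≡ d
  down refl = ℕP.m+n∸m≡n p d
  not-below : q ≢ p ∸ d
  not-below refl = ℕP.<-irrefl refl
    (ℕP.≤-<-trans p≤q (ℕP.∸-monoʳ-< {o = 0} 1≤d (ℕP.<⇒≤ (positive-∸ 1≤q))))

inRange-distance : ∀ n p q → p ≤ n → q ≤ n → inRange n (ℕ.∣ p - q ∣) ≡ not (q == p)
inRange-distance n p q p≤n q≤n with q ℕ.≟ p
... | yes refl rewrite ℕP.∣n-n∣≡0 q | dec-true (q ℕ.≟ q) refl = refl
... | no q≢p rewrite dec-true (1 ℕ.≤? ℕ.∣ p - q ∣) (ℕP.n≢0⇒n>0 (q≢p ∘ sym ∘ ℕP.∣m-n∣≡0⇒m≡n))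
                   | dec-true (ℕ.∣ p - q ∣ ℕ.≤? n) (ℕP.≤-trans (ℕP.∣m-n∣≤m⊔n p q) (ℕP.⊔-lub p≤n q≤n))
                   | dec-false (q ℕ.≟ p) q≢p = refl

module ∧-Solver = ICM-Solver ∧-idempotentCommutativeMonoid

not-∨ : ∀ x y → not (x ∨ y) ≡ not x ∧ not y
not-∨ true  y = refl
not-∨ false y = refl

-- Unfolded, the adjacency condition of p and q is a rearrangement (with
-- repetitions) of seven exclusions; the solver for idempotent commutative
-- monoids, applied to (Bool, ∧, true), checks this.
exclusions-rearranged : ∀ eᵢ eⱼ eₚ e₊ᵢ e₋ᵢ e₊ⱼ e₋ⱼ →
  (not eᵢ ∧ not eⱼ) ∧ not eₚ ∧ ((not eᵢ ∧ not eⱼ) ∧ true) ∧ (not (e₊ᵢ ∨ e₋ᵢ) ∧ not (e₊ⱼ ∨ e₋ⱼ)) ∧ not eₚ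
  ≡ not e₋ⱼ ∧ not e₊ⱼ ∧ not e₋ᵢ ∧ not e₊ᵢ ∧ not eₚ ∧ not eⱼ ∧ not eᵢ ∧ true
exclusions-rearranged eᵢ eⱼ eₚ e₊ᵢ e₋ᵢ e₊ⱼ e₋ⱼ rewrite not-∨ e₊ᵢ e₋ᵢ | not-∨ e₊ⱼ e₋ⱼ =
  prove 7 ((xᵢ ⊕ xⱼ) ⊕ xₚ ⊕ ((xᵢ ⊕ xⱼ) ⊕ id) ⊕ ((x₊ᵢ ⊕ x₋ᵢ) ⊕ (x₊ⱼ ⊕ x₋ⱼ)) ⊕ xₚ)
          (x₋ⱼ ⊕ x₊ⱼ ⊕ x₋ᵢ ⊕ x₊ᵢ ⊕ xₚ ⊕ xⱼ ⊕ xᵢ ⊕ id)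
          (not eᵢ ∷ not eⱼ ∷ not eₚ ∷ not e₊ᵢ ∷ not e₋ᵢ ∷ not e₊ⱼ ∷ not e₋ⱼ ∷ [])
  where
  open ∧-Solver
  xᵢ = var (# 0); xⱼ = var (# 1); xₚ = var (# 2)
  x₊ᵢ = var (# 3); x₋ᵢ = var (# 4); x₊ⱼ = var (# 5); x₋ⱼ = var (# 6)

forbidden : ℕ → ℕ → ℕ → List ℕ
forbidden p i j = (p ∸ j) ∷ (p + j) ∷ (p ∸ i) ∷ (p + i) ∷ p ∷ j ∷ i ∷ []

==-sym : ∀ m n → (m == n) ≡ (n == m)
==-sym m n = does-⇔ (mk⇔ sym sym) (m ℕ.≟ n) (n ℕ.≟ m)

neighbour-iff : ∀ s n i j p → 0 < s → 1 ≤ i → 1 ≤ j → 1 ≤ p → p ≤ n → p ≢ i → p ≢ j →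
  ∀ q → 1 ≤ q → q ≤ n →
  kept i j q ∧ adjᵇ (sigH s n i j) (+ (p * s)) (+ (q * s)) ≡ notIn (forbidden p i j) q
neighbour-iff s n i j p s>0 1≤i 1≤j 1≤p p≤n p≢i p≢j q 1≤q q≤n
  rewrite distance-scaled p q s | scaled-== s p q s>0
        | memᵇ-sigH s n i j p s>0 | memᵇ-sigH s n i j q s>0 | memᵇ-sigH s n i j (ℕ.∣ p - q ∣) s>0
        | dec-false (p ℕ.≟ i) p≢i | dec-false (p ℕ.≟ j) p≢j
        | dec-true (1 ℕ.≤? p) 1≤p | dec-true (p ℕ.≤? n) p≤n
        | dec-true (1 ℕ.≤? q) 1≤q | dec-true (q ℕ.≤? n) q≤n
        | inRange-distance n p q p≤n q≤n | ==-sym p q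
        | distance-== p q i 1≤q 1≤i | distance-== p q j 1≤q 1≤j
  = exclusions-rearranged (q == i) (q == j) (q == p) (q == (p + i)) (q == (p ∸ i)) (q == (p + j)) (q == (p ∸ j))

+-==-∸ : ∀ p a b → a ≤ b → ((p + a) == b) ≡ (p == (b ∸ a))
+-==-∸ p a b a≤b = does-⇔ (mk⇔ (λ eq → sym (trans (cong (_∸ a) (sym eq)) (ℕP.m+n∸n≡m p a)))
                                (λ eq → trans (cong (_+ a) eq) (ℕP.m∸n+n≡m a≤b)))
                          (p + a ℕ.≟ b) (p ℕ.≟ b ∸ a)

∸-==-+ : ∀ p a b → 1 ≤ b → ((p ∸ a) == b) ≡ (p == (a + b))
∸-==-+ p a b 1≤b = does-⇔ (mk⇔ to (λ eq → trans (cong (_∸ a) eq) (ℕP.m+n∸m≡n a b)))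
                          (p ∸ a ℕ.≟ b) (p ℕ.≟ a + b)
  where
  to : p ∸ a ≡ b → p ≡ a + b
  to refl = sym (ℕP.m+[n∸m]≡n {a} {p} (ℕP.<⇒≤ (positive-∸ 1≤b)))

+-≤ᵇ-∸ : ∀ p a n → a ≤ n → ((p + a) ≤ᵇ n) ≡ (p ≤ᵇ (n ∸ a))
+-≤ᵇ-∸ p a n a≤n = does-⇔ (mk⇔ (ℕP.m+n≤o⇒m≤o∸n p) (ℕP.m≤o∸n⇒m+n≤o p a≤n)) (p + a ℕ.≤? n) (p ℕ.≤? n ∸ a)

1≤ᵇ∸ : ∀ a p → (1 ≤ᵇ (p ∸ a)) ≡ (a <ᵇ p)
1≤ᵇ∸ a p = does-⇔ (mk⇔ positive-∸ ℕP.m<n⇒0<n∸m) (1 ℕ.≤? p ∸ a) (a ℕ.<? p)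

∸-≢ : ∀ p a → 1 ≤ p → 1 ≤ a → p ∸ a ≢ p
∸-≢ p a 1≤p 1≤a with a ℕ.≤? p
... | yes a≤p = ℕP.<⇒≢ (ℕP.∸-monoʳ-< {o = 0} 1≤a a≤p)
... | no  a≰p = λ p∸a≡p → ℕP.<-irrefl (trans (sym (ℕP.m≤n⇒m∸n≡0 (ℕP.<⇒≤ (ℕP.≰⇒> a≰p)))) p∸a≡p) 1≤p

double : ∀ i → i + i ≡ 2 * i
double i = cong (λ k → i + k) (sym (ℕP.+-identityʳ i))

⊔-<ᵇ : ∀ x y p → ((x ℕ.⊔ y) <ᵇ p) ≡ (x <ᵇ p) ∧ not (p ≤ᵇ y)
⊔-<ᵇ x y p = does-⇔ (mk⇔ to from) (x ℕ.⊔ y ℕ.<? p) ((x ℕ.<? p) ×-dec ¬? (p ℕ.≤? y))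
  where
  to : x ℕ.⊔ y < p → x < p × ¬ p ≤ y
  to x⊔y<p = ℕP.≤-<-trans (ℕP.m≤m⊔n x y) x⊔y<p , ℕP.<⇒≱ (ℕP.≤-<-trans (ℕP.m≤n⊔m x y) x⊔y<p)
  from : x < p × ¬ p ≤ y → x ℕ.⊔ y < p
  from (x<p , p≰y) = ℕP.⊔-pres-<m x<p (ℕP.≰⇒> p≰y)

≤ᵇ-⊓ : ∀ p x y → (p ≤ᵇ (x ℕ.⊓ y)) ≡ (p ≤ᵇ x) ∧ not (y <ᵇ p)
≤ᵇ-⊓ p x y = does-⇔ (mk⇔ to from) (p ℕ.≤? x ℕ.⊓ y) ((p ℕ.≤? x) ×-dec ¬? (y ℕ.<? p))
  where
  to : p ≤ x ℕ.⊓ y → p ≤ x × ¬ y < p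
  to p≤x⊓y = ℕP.≤-trans p≤x⊓y (ℕP.m⊓n≤m x y) , ℕP.≤⇒≯ (ℕP.≤-trans p≤x⊓y (ℕP.m⊓n≤n x y))
  from : p ≤ x × ¬ y < p → p ≤ x ℕ.⊓ y
  from (p≤x , y≮p) = ℕP.⊓-glb p≤x (ℕP.≮⇒≥ y≮p)

<ᵇ-not-≤ᵇ : ∀ y p → (y <ᵇ p) ≡ not (p ≤ᵇ y)
<ᵇ-not-≤ᵇ y p = does-⇔ (mk⇔ ℕP.<⇒≱ ℕP.≰⇒>) (y ℕ.<? p) (¬? (p ℕ.≤? y))

<ᵇ-flip : ∀ p j → p ≢ j → (p <ᵇ j) ≡ not (j <ᵇ p)
<ᵇ-flip p j p≢j = does-⇔ (mk⇔ ℕP.<⇒≯ (λ j≮p → ℕP.≤∧≢⇒< (ℕP.≮⇒≥ j≮p) p≢j)) (p ℕ.<? j) (¬? (j ℕ.<? p))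

-- The paper's five-way case split, written with the four range tests
-- a = [p - i ≥ 1], b = [p - j ≥ 1], c = [p + i ≤ n], d = [p + j ≤ n].
caseShape : ℕ → (a b c d : Bool) → ℤ
caseShape n a b c d =
  if b ∧ d then + n ℤ.- + 7
  else if ((b ∧ not d) ∧ c) ∨ (a ∧ d ∧ not b) then + n ℤ.- + 6
  else if ((a ∧ not c) ∧ not b) ∨ (not d ∧ c ∧ not a) then + n ℤ.- + 4
  else if not c ∧ not a then + n ℤ.- + 3
  else + n ℤ.- + 5

caseShape-value : ∀ n a b c d → (T b → T a) → (T d → T c) →
  caseShape n a b c d ≡ + n ℤ.- + (3 + ind a 1 + ind b 1 + ind c 1 + ind d 1)
caseShape-value n true  true  true  true  _   _   = refl
caseShape-value n true  true  true  false _   _   = refl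
caseShape-value n true  true  false false _   _   = refl
caseShape-value n true  false true  true  _   _   = refl
caseShape-value n true  false true  false _   _   = refl
caseShape-value n true  false false false _   _   = refl
caseShape-value n false false true  true  _   _   = refl
caseShape-value n false false true  false _   _   = refl
caseShape-value n false false false false _   _   = refl
caseShape-value n false true  _     _     b⇒a _   = ⊥-elim (b⇒a _)
caseShape-value n _     _     false true  _   d⇒c = ⊥-elim (d⇒c _)

ind-split : ∀ a e g → (T e → T a) → (T g → T a) → (T e → ¬ T g) →
  ind (a ∧ not e ∧ not g) 1 + ind e 1 + ind g 1 ≡ ind a 1
ind-split true  false false _   _   _    = refl
ind-split true  true  false _   _   _    = refl
ind-split true  false true  _   _   _    = refl
ind-split true  true  true  _   _   e⇏g = ⊥-elim (e⇏g _ _)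
ind-split false false false _   _   _    = refl
ind-split false true  _     e⇒a _   _    = ⊥-elim (e⇒a _)
ind-split false false true  _   g⇒a _    = ⊥-elim (g⇒a _)

ind-double : ∀ x → ind x 2 ≡ ind x 1 + ind x 1
ind-double true  = refl
ind-double false = refl

does-sound : ∀ {P : Set} (P? : Dec P) → T (does P?) → P
does-sound (yes p) _ = p

does-complete : ∀ {P : Set} (P? : Dec P) → P → T (does P?)
does-complete (yes _) _ = _
does-complete (no ¬p) p = ¬p p

-- p = 2k with p ≤ n already forces k ≤ ⌊n/2⌋, so the paper's side condition
-- in ε is automatic.
double-≤-half : ∀ n k p → p ≤ n → (p == (2 * k)) ∧ (k ≤ᵇ (n / 2)) ≡ (p == (2 * k))
double-≤-half n k p p≤n with p ℕ.≟ 2 * k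
... | no p≢2k rewrite dec-false (p ℕ.≟ 2 * k) p≢2k = refl
... | yes refl rewrite dec-true (2 * k ℕ.≟ 2 * k) refl = dec-true (k ℕ.≤? n / 2) k≤n/2
  where
  k≤n/2 : k ≤ n / 2
  k≤n/2 = subst (_≤ n / 2) (m*n/n≡m k 2) (/-monoˡ-≤ 2 (subst (_≤ n) (ℕP.*-comm 2 k) p≤n))

rearrange : ∀ xa xb xc d eᵢ eⱼ g h →
  3 + (xa + g + eᵢ) + (xb + eⱼ + g) + (xc + h + 0) + d ≡ (xb + (d + (xa + (xc + 3)))) + (eᵢ + eⱼ + (g + g) + h)
rearrange = solve-∀

subtract-count : ∀ {x y n} e → x + y ≡ n → + x ≡ + e ℤ.+ (+ n ℤ.- + (y + e))
subtract-count {x} {y} e refl = identity (+ x) (+ y) (+ e)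
  where
  identity : ∀ (X Y E : ℤ) → X ≡ E ℤ.+ ((X ℤ.+ Y) ℤ.- (Y ℤ.+ E))
  identity = ℤ-solve-∀

degree-complement : ∀ s n i j p → 0 < s → 1 ≤ i → 1 ≤ j → 1 ≤ p → p ≤ n → p ≢ i → p ≢ j →
  degree (sigH s n i j) (+ (p * s)) + distinctIn n (forbidden p i j) ≡ n
degree-complement s n i j p s>0 1≤i 1≤j 1≤p p≤n p≢i p≢j = begin
  degree (sigH s n i j) (+ (p * s)) + distinctIn n (forbidden p i j)
    ≡⟨ cong (_+ distinctIn n (forbidden p i j)) neighbours ⟩
  count n (notIn (forbidden p i j)) + distinctIn n (forbidden p i j)
    ≡⟨ count-avoiding n (forbidden p i j) ⟩
  n ∎
  where
  open ≡-Reasoning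
  neighbours : degree (sigH s n i j) (+ (p * s)) ≡ count n (notIn (forbidden p i j))
  neighbours = trans (degree-as-count s n i j p)
    (count-cong n _ _ (neighbour-iff s n i j p s>0 1≤i 1≤j 1≤p p≤n p≢i p≢j))

module Vertex (n i j p : ℕ) (1≤i : 1 ≤ i) (i<j : i < j) (j≤n : j ≤ n)
              (1≤p : 1 ≤ p) (p≤n : p ≤ n) (p≢i : p ≢ i) (p≢j : p ≢ j) where

  1≤j : 1 ≤ j
  1≤j = ℕP.<-trans 1≤i i<j

  i≤n : i ≤ n
  i≤n = ℕP.≤-trans (ℕP.<⇒≤ i<j) j≤n

  -- The atoms of the formula: a, b, c, d say that p - i, p - j, p + i, p + j
  -- are labels in [1, n]; εᵢ, εⱼ, γ, β are the paper's coincidence tests.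
  a b c d εᵢ εⱼ γ β : Bool
  a  = i <ᵇ p
  b  = j <ᵇ p
  c  = p ≤ᵇ (n ∸ i)
  d  = p ≤ᵇ (n ∸ j)
  εᵢ = p == (2 * i)
  εⱼ = p == (2 * j)
  γ  = p == (i + j)
  β  = p == (j ∸ i)

  new-i : inRange n i ∧ notIn [] i ≡ true
  new-i rewrite dec-true (1 ℕ.≤? i) 1≤i | dec-true (i ℕ.≤? n) i≤n = refl

  new-j : inRange n j ∧ notIn (i ∷ []) j ≡ true
  new-j rewrite dec-true (1 ℕ.≤? j) 1≤j | dec-true (j ℕ.≤? n) j≤n
              | dec-false (j ℕ.≟ i) (ℕP.>⇒≢ i<j) = refl

  new-p : inRange n p ∧ notIn (j ∷ i ∷ []) p ≡ true
  new-p rewrite dec-true (1 ℕ.≤? p) 1≤p | dec-true (p ℕ.≤? n) p≤n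
              | dec-false (p ℕ.≟ i) p≢i | dec-false (p ℕ.≟ j) p≢j = refl

  new-p+i : inRange n (p + i) ∧ notIn (p ∷ j ∷ i ∷ []) (p + i) ≡ c ∧ not β ∧ not false
  new-p+i
    rewrite dec-true (1 ℕ.≤? p + i) (ℕP.≤-trans 1≤p (ℕP.m≤m+n p i)) | +-≤ᵇ-∸ p i n i≤n
          | dec-false (p + i ℕ.≟ p) (ℕP.>⇒≢ (ℕP.m<m+n p 1≤i)) | +-==-∸ p i j (ℕP.<⇒≤ i<j)
          | dec-false (p + i ℕ.≟ i) (ℕP.>⇒≢ (ℕP.m<n+m i 1≤p)) = refl

  new-p-i : inRange n (p ∸ i) ∧ notIn ((p + i) ∷ p ∷ j ∷ i ∷ []) (p ∸ i) ≡ a ∧ not γ ∧ not εᵢ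
  new-p-i
    rewrite 1≤ᵇ∸ i p | dec-true (p ∸ i ℕ.≤? n) (ℕP.≤-trans (ℕP.m∸n≤m p i) p≤n)
          | dec-false (p ∸ i ℕ.≟ p + i) (ℕP.<⇒≢ (ℕP.≤-<-trans (ℕP.m∸n≤m p i) (ℕP.m<m+n p 1≤i)))
          | dec-false (p ∸ i ℕ.≟ p) (∸-≢ p i 1≤p 1≤i)
          | ∸-==-+ p i j 1≤j | ∸-==-+ p i i 1≤i | double i
          | ∧-identityʳ a | ∧-identityʳ (not εᵢ) = refl

  -- p + j is a new label iff p + j ≤ n: it exceeds all the other values.
  new-p+j : inRange n (p + j) ∧ notIn ((p ∸ i) ∷ (p + i) ∷ p ∷ j ∷ i ∷ []) (p + j) ≡ d
  new-p+j
    rewrite dec-true (1 ℕ.≤? p + j) (ℕP.≤-trans 1≤p (ℕP.m≤m+n p j)) | +-≤ᵇ-∸ p j n j≤n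
          | dec-false (p + j ℕ.≟ p ∸ i) (ℕP.>⇒≢ (ℕP.≤-<-trans (ℕP.m∸n≤m p i) (ℕP.m<m+n p 1≤j)))
          | dec-false (p + j ℕ.≟ p + i) (ℕP.>⇒≢ (ℕP.+-monoʳ-< p i<j))
          | dec-false (p + j ℕ.≟ p) (ℕP.>⇒≢ (ℕP.m<m+n p 1≤j))
          | dec-false (p + j ℕ.≟ j) (ℕP.>⇒≢ (ℕP.m<n+m j 1≤p))
          | dec-false (p + j ℕ.≟ i) (ℕP.>⇒≢ (ℕP.<-≤-trans i<j (ℕP.m≤n+m j p)))
          | ∧-identityʳ d = refl

  new-p-j : inRange n (p ∸ j) ∧ notIn ((p + j) ∷ (p ∸ i) ∷ (p + i) ∷ p ∷ j ∷ i ∷ []) (p ∸ j)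
            ≡ b ∧ not εⱼ ∧ not γ
  new-p-j with j ℕ.<? p
  ... | no j≮p rewrite ℕP.m≤n⇒m∸n≡0 (ℕP.≮⇒≥ j≮p) | dec-false (j ℕ.<? p) j≮p = refl
  ... | yes j<p
    rewrite dec-true (j ℕ.<? p) j<p | dec-true (1 ℕ.≤? p ∸ j) (ℕP.m<n⇒0<n∸m j<p)
          | dec-true (p ∸ j ℕ.≤? n) (ℕP.≤-trans (ℕP.m∸n≤m p j) p≤n)
          | dec-false (p ∸ j ℕ.≟ p + j) (ℕP.<⇒≢ (ℕP.≤-<-trans (ℕP.m∸n≤m p j) (ℕP.m<m+n p 1≤j)))
          | dec-false (p ∸ j ℕ.≟ p ∸ i) (ℕP.<⇒≢ (ℕP.∸-monoʳ-< i<j (ℕP.<⇒≤ j<p)))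
          | dec-false (p ∸ j ℕ.≟ p + i) (ℕP.<⇒≢ (ℕP.≤-<-trans (ℕP.m∸n≤m p j) (ℕP.m<m+n p 1≤i)))
          | dec-false (p ∸ j ℕ.≟ p) (∸-≢ p j 1≤p 1≤j)
          | ∸-==-+ p j j 1≤j | double j | ∸-==-+ p j i 1≤i | ℕP.+-comm j i
          | ∧-identityʳ (not γ) = refl

  distinct-forbidden : distinctIn n (forbidden p i j)
    ≡ ind (b ∧ not εⱼ ∧ not γ) 1 + (ind d 1 + (ind (a ∧ not γ ∧ not εᵢ) 1 + (ind (c ∧ not β ∧ not false) 1 + 3)))
  distinct-forbidden rewrite new-p-j | new-p+j | new-p-i | new-p+i | new-p | new-j | new-i = refl

  b⇒a : T b → T a
  b⇒a = does-complete (i ℕ.<? p) ∘ ℕP.<-trans i<j ∘ does-sound (j ℕ.<? p)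

  d⇒c : T d → T c
  d⇒c = does-complete (p ℕ.≤? n ∸ i) ∘ (λ p≤n-j → ℕP.≤-trans p≤n-j (ℕP.∸-monoʳ-≤ n (ℕP.<⇒≤ i<j)))
      ∘ does-sound (p ℕ.≤? n ∸ j)

  εᵢ⇒a : T εᵢ → T a
  εᵢ⇒a = does-complete (i ℕ.<? p) ∘ (λ { refl → subst (i <_) (double i) (ℕP.m<m+n i 1≤i) })
       ∘ does-sound (p ℕ.≟ 2 * i)

  εⱼ⇒b : T εⱼ → T b
  εⱼ⇒b = does-complete (j ℕ.<? p) ∘ (λ { refl → subst (j <_) (double j) (ℕP.m<m+n j 1≤j) })
       ∘ does-sound (p ℕ.≟ 2 * j)

  γ⇒a : T γ → T a
  γ⇒a = does-complete (i ℕ.<? p) ∘ (λ { refl → ℕP.m<m+n i 1≤j }) ∘ does-sound (p ℕ.≟ i + j)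

  γ⇒b : T γ → T b
  γ⇒b = does-complete (j ℕ.<? p) ∘ (λ { refl → ℕP.m<n+m j 1≤i }) ∘ does-sound (p ℕ.≟ i + j)

  β⇒c : T β → T c
  β⇒c = does-complete (p ℕ.≤? n ∸ i) ∘ (λ { refl → ℕP.∸-monoˡ-≤ i j≤n }) ∘ does-sound (p ℕ.≟ j ∸ i)

  γ⇏εᵢ : T γ → ¬ T εᵢ
  γ⇏εᵢ tγ tεᵢ with does-sound (p ℕ.≟ i + j) tγ | does-sound (p ℕ.≟ 2 * i) tεᵢ
  ... | refl | i+j≡2i = ℕP.>⇒≢ i<j (ℕP.+-cancelˡ-≡ i j i (trans i+j≡2i (sym (double i))))

  εⱼ⇏γ : T εⱼ → ¬ T γ
  εⱼ⇏γ tεⱼ tγ with does-sound (p ℕ.≟ 2 * j) tεⱼ | does-sound (p ℕ.≟ i + j) tγ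
  ... | refl | 2j≡i+j = ℕP.>⇒≢ i<j (ℕP.+-cancelʳ-≡ j j i (trans (double j) 2j≡i+j))

  -- The number of range tests that hold exceeds the number of distinct
  -- forbidden values by ε_i + ε_j + 2γ + β (each coincidence hides a value).
  extras-sum : ℕ
  extras-sum = ind εᵢ 1 + ind εⱼ 1 + ind γ 2 + ind β 1

  range-tally : 3 + ind a 1 + ind b 1 + ind c 1 + ind d 1 ≡ distinctIn n (forbidden p i j) + extras-sum
  range-tally = begin
    3 + ind a 1 + ind b 1 + ind c 1 + ind d 1
      ≡⟨ cong₂ (λ x y → 3 + x + y + ind c 1 + ind d 1) split-a split-b ⟨
    3 + xa + xb + ind c 1 + ind d 1
      ≡⟨ cong (λ z → 3 + xa + xb + z + ind d 1) split-c ⟨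
    3 + xa + xb + xc + ind d 1
      ≡⟨ rearrange (ind (a ∧ not γ ∧ not εᵢ) 1) (ind (b ∧ not εⱼ ∧ not γ) 1) (ind (c ∧ not β ∧ not false) 1)
                   (ind d 1) (ind εᵢ 1) (ind εⱼ 1) (ind γ 1) (ind β 1) ⟩
    ind (b ∧ not εⱼ ∧ not γ) 1 + (ind d 1 + (ind (a ∧ not γ ∧ not εᵢ) 1 + (ind (c ∧ not β ∧ not false) 1 + 3)))
      + (ind εᵢ 1 + ind εⱼ 1 + (ind γ 1 + ind γ 1) + ind β 1)
      ≡⟨ cong₂ (λ x y → x + (ind εᵢ 1 + ind εⱼ 1 + y + ind β 1)) distinct-forbidden (ind-double γ) ⟨
    distinctIn n (forbidden p i j) + extras-sum ∎
    where
    open ≡-Reasoning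
    xa = ind (a ∧ not γ ∧ not εᵢ) 1 + ind γ 1 + ind εᵢ 1
    xb = ind (b ∧ not εⱼ ∧ not γ) 1 + ind εⱼ 1 + ind γ 1
    xc = ind (c ∧ not β ∧ not false) 1 + ind β 1 + ind false 1
    split-a : xa ≡ ind a 1
    split-a = ind-split a γ εᵢ γ⇒a εᵢ⇒a γ⇏εᵢ
    split-b : xb ≡ ind b 1
    split-b = ind-split b εⱼ γ εⱼ⇒b γ⇒b εⱼ⇏γ
    split-c : xc ≡ ind c 1
    split-c = ind-split c β false β⇒c (λ ()) (λ _ ())

  caseTerm-value : caseTerm n i j p ≡ + n ℤ.- + (3 + ind a 1 + ind b 1 + ind c 1 + ind d 1)
  caseTerm-value = trans shape (caseShape-value n a b c d b⇒a d⇒c)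
    where
    shape : caseTerm n i j p ≡ caseShape n a b c d
    shape rewrite ⊔-<ᵇ j (n ∸ j) p | ⊔-<ᵇ i (n ∸ i) p | ≤ᵇ-⊓ p (n ∸ j) j | ≤ᵇ-⊓ p (n ∸ i) i
                | <ᵇ-flip p j p≢j | <ᵇ-flip p i p≢i | <ᵇ-not-≤ᵇ (n ∸ j) p | <ᵇ-not-≤ᵇ (n ∸ i) p = refl

  extras-value : extras n i j p ≡ extras-sum
  extras-value rewrite double-≤-half n i p p≤n | double-≤-half n j p p≤n = refl

lemma4 : (s n i j : ℕ) → 0 < s → 3 ≤ n → 1 ≤ i → i < j → j ≤ n →
         (p : ℕ) → 1 ≤ p → p ≤ n → p ≢ i → p ≢ j →
         + degree (sigH s n i j) (+ (p * s))
           ≡ + extras n i j p ℤ.+ caseTerm n i j p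
lemma4 s n i j s>0 _ 1≤i i<j j≤n p 1≤p p≤n p≢i p≢j = begin
  + degree (sigH s n i j) (+ (p * s))
    ≡⟨ subtract-count extras-sum (degree-complement s n i j p s>0 1≤i 1≤j 1≤p p≤n p≢i p≢j) ⟩
  + extras-sum ℤ.+ (+ n ℤ.- + (distinctIn n (forbidden p i j) + extras-sum))
    ≡⟨ cong (λ m → + extras-sum ℤ.+ (+ n ℤ.- + m)) range-tally ⟨
  + extras-sum ℤ.+ (+ n ℤ.- + (3 + ind a 1 + ind b 1 + ind c 1 + ind d 1))
    ≡⟨ cong₂ (λ e t → + e ℤ.+ t) extras-value caseTerm-value ⟨
  + extras n i j p ℤ.+ caseTerm n i j p ∎
  where
  open ≡-Reasoning
  open Vertex n i j p 1≤i i<j j≤n 1≤p p≤n p≢i p≢j
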